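{- Let $T$ be a plane tree with $n$ edges whose vertices are labelled $0,1,\dots,n$ in the order in which they are visited by the right-to-left preorder traversal. Let $0\le m\le n$ and let $w$ be the vertex labelled $m$. Then the doubly rooted plane tree $(T,w)$ corresponds, under the bijection $\Phi$ described below, to a free Dyck path having exactly $m$ down steps (equivalently, $m$ up steps) below the $x$-axis.
   Context: A plane tree is a rooted tree with linearly ordered children. The right-to-left preorder traversal of a plane tree visits the root first and then, if the subtrees of the root are $T_1,\dots,T_k$ from left to right, recursively traverses $T_k,T_{k-1},\dots,T_1$ in this order. A free Dyck path of length $2n$ is a lattice path from $(0,0)$ to $(2n,0)$ with $n$ up steps $U=(1,1)$ and $n$ down steps $D=(1,-1)$; a step is below the $x$-axis if it lies in the half-plane $y\le 0$ and is not on the axis (i.e. connects heights $-j$ and $-j+1$ for some $j\ge1$). The glove bijection sends a plane tree to the Dyck path obtained by a left-to-right preorder (depth-first) traversal, writing $U$ when an edge is traversed downward and $D$ when it is traversed back upward. Butterfly decomposition: for a plane tree $T$ with distinguished vertex $w$, let $v_1v_2\cdots v_kw$ be the path from the root $v_1$ to $w$ (with $k=0$ if $w$ is the root), set $v_{k+1}=w$; let $L_i$ be the subtree consisting of $v_i$ and all descendants of $v_i$ through children of $v_i$ to the left of $v_{i+1}$, $R_i$ the analogous subtree for children to the right of $v_{i+1}$, and $T'$ the subtree rooted at $w$. The bijection $\Phi$: let $P_i$ ($1\le i\le k$) be the glove image of $L_i$ and $P_{k+1}$ that of $T'$; let $Q_i$ be obtained by adding a new root above the root of $R_i$ (joined by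 one edge), taking the glove image, and reflecting it in the $x$-axis. Then $\Phi(T,w)=P_1Q_1P_2Q_2\cdots P_kQ_kP_{k+1}$. -}

module Defs where

open import Data.Nat using (ℕ; zero; suc; _+_)
open import Data.Integer as ℤ using (ℤ; +_; _≤ᵇ_)
open import Data.Fin using (Fin; zero; suc; toℕ)
open import Data.List using (List; []; _∷_; _++_; map; length; take; drop; lookup)
open import Data.Product using (Σ; _,_)
open import Data.Maybe using (Maybe; just; nothing)
open import Data.Bool using (if_then_else_)

-- Plane trees: a vertex with an ordered (left-to-right) list of subtrees.
data Tree : Set where
  node : List Tree → Tree

mutual
  edges : Tree → ℕ
  edges (node ts) = edgesF ts

  edgesF : List Tree → ℕ
  edgesF [] = 0
  edgesF (t ∷ ts) = suc (edges t) + edgesF ts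

-- Vertices of a plane tree, given by their position (path from the root):
-- `here` is the root; `there i p` is vertex p of the i-th subtree (from the left).
data Pos : Tree → Set where
  here  : {t : Tree} → Pos t
  there : {ts : List Tree} (i : Fin (length ts)) → Pos (lookup ts i) → Pos (node ts)

-- Right-to-left preorder: root first, then subtrees T_k, ..., T_1 recursively.
mutual
  rtl : (t : Tree) → List (Pos t)
  rtl (node ts) = here ∷ map (λ { (i , p) → there i p }) (rtlF ts)

  rtlF : (ts : List Tree) → List (Σ (Fin (length ts)) (λ i → Pos (lookup ts i)))
  rtlF [] = []
  rtlF (t ∷ ts) = map (λ { (i , p) → (suc i , p) }) (rtlF ts) ++ map (λ p → (zero , p)) (rtl t)

nth : {A : Set} → List A → ℕ → Maybe A
nth [] _ = nothing
nth (x ∷ xs) zero = just x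
nth (x ∷ xs) (suc m) = nth xs m

vertexLabelled : (t : Tree) → ℕ → Maybe (Pos t)
vertexLabelled t m = nth (rtl t) m

data Step : Set where
  U D : Step

Path : Set
Path = List Step

-- glove bijection: left-to-right depth-first traversal, U going down an edge, D going back up
mutual
  glove : Tree → Path
  glove (node ts) = gloveF ts

  gloveF : List Tree → Path
  gloveF [] = []
  gloveF (t ∷ ts) = (U ∷ glove t ++ (D ∷ [])) ++ gloveF ts

flipStep : Step → Step
flipStep U = D
flipStep D = U

reflect : Path → Path
reflect = map flipStep

-- At a vertex node ts with path continuing
-- into child i: L = root with children left of child i, R = root with children
-- right of child i; emit glove(L), reflect(glove(new root above R)), then recurse.
Φ : (t : Tree) → Pos t → Path
Φ t here = glove t
Φ (node ts) (there i p) =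
  glove (node (take (toℕ i) ts))
  ++ reflect (glove (node (node (drop (suc (toℕ i)) ts) ∷ [])))
  ++ Φ (lookup ts i) p

-- number of down steps below the x-axis, walking from current height h:
-- a down step from h to h-1 is below the axis iff h ≤ 0.
downsBelowFrom : ℤ → Path → ℕ
downsBelowFrom h [] = 0
downsBelowFrom h (U ∷ s) = downsBelowFrom (h ℤ.+ + 1) s
downsBelowFrom h (D ∷ s) =
  (if h ≤ᵇ + 0 then 1 else 0) + downsBelowFrom (h ℤ.- + 1) s

downsBelow : Path → ℕ
downsBelow = downsBelowFrom (+ 0)

-- Labelling every vertex w of T by downsBelow (Φ T w) reproduces the right-to-left
-- preorder labelling.  Below the axis, Φ (T , w) only ever visits the reflected pieces
-- Q_i: each P_i is a Dyck path started at height ≥ 0, while each Q_i starts with a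
-- down step from the current height and then stays strictly below it, so it
-- contributes one down step per edge of the new root over R_i.  Hence a vertex in
-- the i-th subtree of the root gets label 1 + (edges of the subtrees to its right)
-- + (its label inside the i-th subtree), which is the recursion of the preorder.
module Submission where

open import Defs
open import Data.Nat using (ℕ; _≤_)
open import Data.Maybe using (just)
open import Data.Product using (Σ; _×_)
open import Relation.Binary.PropositionalEquality using (_≡_)

open import Data.Nat using (zero; suc; _+_; _<_; s≤s)
open import Data.Nat.Properties using (+-comm; +-assoc; +-identityʳ)
open import Data.Integer as ℤ using (-[1+_])
open import Data.Fin using (Fin; toℕ)
open import Data.List using (List; []; _∷_; _++_; map; length; take; drop; lookup; applyUpTo; upTo)
open import Data.List.Properties using (++-assoc; ++-identityʳ; map-++; map-∘; map-cong; map-upTo)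
open import Data.Maybe using (Maybe)
import Data.Maybe as Maybe
open import Data.Product using (_,_)
open import Function using (_∘_)
open import Relation.Binary.PropositionalEquality using (refl; sym; trans; cong; cong₂; module ≡-Reasoning)

private
  variable
    A B : Set

nth-map : (f : A → B) (xs : List A) (m : ℕ) → nth (map f xs) m ≡ Maybe.map f (nth xs m)
nth-map f []       m       = refl
nth-map f (x ∷ xs) zero    = refl
nth-map f (x ∷ xs) (suc m) = nth-map f xs m

nth-applyUpTo : (f : ℕ → A) {n m : ℕ} → m < n → nth (applyUpTo f n) m ≡ just (f m)
nth-applyUpTo f {suc n} {zero}  _         = refl
nth-applyUpTo f {suc n} {suc m} (s≤s m<n) = nth-applyUpTo (f ∘ suc) m<n

applyUpTo-+ : (f : ℕ → A) (m n : ℕ) → applyUpTo f (m + n) ≡ applyUpTo f m ++ applyUpTo (f ∘ (m +_)) n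
applyUpTo-+ f zero    n = refl
applyUpTo-+ f (suc m) n = cong (f 0 ∷_) (applyUpTo-+ (f ∘ suc) m n)

upTo-+ : (m n : ℕ) → upTo (m + n) ≡ upTo m ++ map (m +_) (upTo n)
upTo-+ m n = trans (applyUpTo-+ (λ x → x) m n) (cong (upTo m ++_) (sym (map-upTo (m +_) n)))

map-≡-just : (f : A → B) {mx : Maybe A} {y : B} → Maybe.map f mx ≡ just y →
  Σ A (λ x → (mx ≡ just x) × (f x ≡ y))
map-≡-just f {just x} refl = x , refl , refl

gloveF-∷-++ : (us ts : List Tree) (s : Path) →
  gloveF (node us ∷ ts) ++ s ≡ U ∷ gloveF us ++ D ∷ gloveF ts ++ s
gloveF-∷-++ us ts s = cong (U ∷_) (begin
    ((gloveF us ++ D ∷ []) ++ gloveF ts) ++ s  ≡⟨ ++-assoc (gloveF us ++ D ∷ []) (gloveF ts) s ⟩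
    (gloveF us ++ D ∷ []) ++ gloveF ts ++ s    ≡⟨ ++-assoc (gloveF us) (D ∷ []) (gloveF ts ++ s) ⟩
    gloveF us ++ D ∷ gloveF ts ++ s            ∎)
  where open ≡-Reasoning

reflect-gloveF-∷-++ : (us ts : List Tree) (s : Path) →
  reflect (gloveF (node us ∷ ts)) ++ s ≡ D ∷ reflect (gloveF us) ++ U ∷ reflect (gloveF ts) ++ s
reflect-gloveF-∷-++ us ts s = begin
    reflect ((U ∷ gloveF us ++ D ∷ []) ++ gloveF ts) ++ s
      ≡⟨ cong (_++ s) (map-++ flipStep (U ∷ gloveF us ++ D ∷ []) (gloveF ts)) ⟩
    (D ∷ reflect (gloveF us ++ D ∷ []) ++ reflect (gloveF ts)) ++ s
      ≡⟨ cong (λ r → (D ∷ r ++ reflect (gloveF ts)) ++ s) (map-++ flipStep (gloveF us) (D ∷ [])) ⟩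
    D ∷ ((reflect (gloveF us) ++ U ∷ []) ++ reflect (gloveF ts)) ++ s
      ≡⟨ cong (D ∷_) (++-assoc (reflect (gloveF us) ++ U ∷ []) (reflect (gloveF ts)) s) ⟩
    D ∷ (reflect (gloveF us) ++ U ∷ []) ++ reflect (gloveF ts) ++ s
      ≡⟨ cong (D ∷_) (++-assoc (reflect (gloveF us)) (U ∷ []) (reflect (gloveF ts) ++ s)) ⟩
    D ∷ reflect (gloveF us) ++ U ∷ reflect (gloveF ts) ++ s
      ∎
  where open ≡-Reasoning

downsBelowFrom-gloveF-++ : (n : ℕ) (ts : List Tree) (s : Path) →
  downsBelowFrom (ℤ.+ n) (gloveF ts ++ s) ≡ downsBelowFrom (ℤ.+ n) s
downsBelowFrom-gloveF-++ n []             s = refl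
downsBelowFrom-gloveF-++ n (node us ∷ ts) s = begin
    downsBelowFrom (ℤ.+ n) (gloveF (node us ∷ ts) ++ s)
      ≡⟨ cong (downsBelowFrom (ℤ.+ n)) (gloveF-∷-++ us ts s) ⟩
    downsBelowFrom (ℤ.+ (n + 1)) (gloveF us ++ D ∷ gloveF ts ++ s)
      ≡⟨ downsBelowFrom-gloveF-++ (n + 1) us _ ⟩
    downsBelowFrom (ℤ.+ (n + 1)) (D ∷ gloveF ts ++ s)
      ≡⟨ cong (λ k → downsBelowFrom (ℤ.+ k) (D ∷ gloveF ts ++ s)) (+-comm n 1) ⟩
    downsBelowFrom (ℤ.+ n) (gloveF ts ++ s)
      ≡⟨ downsBelowFrom-gloveF-++ n ts s ⟩
    downsBelowFrom (ℤ.+ n) s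
      ∎
  where open ≡-Reasoning

downsBelowFrom-reflect-gloveF-++ : (k : ℕ) (ts : List Tree) (s : Path) →
  downsBelowFrom -[1+ k ] (reflect (gloveF ts) ++ s) ≡ edgesF ts + downsBelowFrom -[1+ k ] s
downsBelowFrom-reflect-gloveF-++ k []             s = refl
downsBelowFrom-reflect-gloveF-++ k (node us ∷ ts) s = begin
    downsBelowFrom -[1+ k ] (reflect (gloveF (node us ∷ ts)) ++ s)
      ≡⟨ cong (downsBelowFrom -[1+ k ]) (reflect-gloveF-∷-++ us ts s) ⟩
    suc (downsBelowFrom -[1+ suc (k + 0) ] (reflect (gloveF us) ++ U ∷ reflect (gloveF ts) ++ s))
      ≡⟨ cong (λ j → suc (downsBelowFrom -[1+ suc j ] (reflect (gloveF us) ++ _))) (+-identityʳ k) ⟩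
    suc (downsBelowFrom -[1+ suc k ] (reflect (gloveF us) ++ U ∷ reflect (gloveF ts) ++ s))
      ≡⟨ cong suc (downsBelowFrom-reflect-gloveF-++ (suc k) us _) ⟩
    suc (edgesF us + downsBelowFrom -[1+ k ] (reflect (gloveF ts) ++ s))
      ≡⟨ cong (λ r → suc (edgesF us + r)) (downsBelowFrom-reflect-gloveF-++ k ts s) ⟩
    suc (edgesF us + (edgesF ts + downsBelowFrom -[1+ k ] s))
      ≡⟨ cong suc (sym (+-assoc (edgesF us) (edgesF ts) _)) ⟩
    suc (edgesF us + edgesF ts + downsBelowFrom -[1+ k ] s)
      ∎
  where open ≡-Reasoning

downsBelow-glove : (t : Tree) → downsBelow (glove t) ≡ 0
downsBelow-glove (node ts) =
  trans (cong downsBelow (sym (++-identityʳ (gloveF ts))))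
        (downsBelowFrom-gloveF-++ 0 ts [])

-- The label, in the right-to-left preorder of node ts, of vertex p of the i-th subtree, minus one.
forestLabel : (ts : List Tree) → Σ (Fin (length ts)) (λ i → Pos (lookup ts i)) → ℕ
forestLabel ts (i , p) = edgesF (drop (suc (toℕ i)) ts) + downsBelow (Φ (lookup ts i) p)

downsBelow-Φ-there : (ts : List Tree) (i : Fin (length ts)) (p : Pos (lookup ts i)) →
  downsBelow (Φ (node ts) (there i p)) ≡ suc (forestLabel ts (i , p))
downsBelow-Φ-there ts i p = begin
    downsBelow (gloveF (take (toℕ i) ts) ++ reflect (gloveF (node R ∷ [])) ++ rest)
      ≡⟨ downsBelowFrom-gloveF-++ 0 (take (toℕ i) ts) _ ⟩
    downsBelow (reflect (gloveF (node R ∷ [])) ++ rest)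
      ≡⟨ cong downsBelow (reflect-gloveF-∷-++ R [] rest) ⟩
    suc (downsBelowFrom -[1+ 0 ] (reflect (gloveF R) ++ U ∷ rest))
      ≡⟨ cong suc (downsBelowFrom-reflect-gloveF-++ 0 R (U ∷ rest)) ⟩
    suc (edgesF R + downsBelow rest)
      ∎
  where
  open ≡-Reasoning
  R = drop (suc (toℕ i)) ts
  rest = Φ (lookup ts i) p

mutual
  downsBelow-Φ-rtl : (t : Tree) → map (downsBelow ∘ Φ t) (rtl t) ≡ upTo (suc (edges t))
  downsBelow-Φ-rtl (node ts) = cong₂ _∷_ (downsBelow-glove (node ts)) (begin
      map (downsBelow ∘ Φ (node ts)) (map _ (rtlF ts))  ≡⟨ sym (map-∘ (rtlF ts)) ⟩
      map _ (rtlF ts)                                    ≡⟨ map-cong (λ { (i , p) → downsBelow-Φ-there ts i p }) (rtlF ts) ⟩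
      map (suc ∘ forestLabel ts) (rtlF ts)               ≡⟨ map-∘ (rtlF ts) ⟩
      map suc (map (forestLabel ts) (rtlF ts))           ≡⟨ cong (map suc) (forestLabel-rtlF ts) ⟩
      map suc (upTo (edgesF ts))                         ≡⟨ map-upTo suc (edgesF ts) ⟩
      applyUpTo suc (edgesF ts)                          ∎)
    where open ≡-Reasoning

  forestLabel-rtlF : (ts : List Tree) → map (forestLabel ts) (rtlF ts) ≡ upTo (edgesF ts)
  forestLabel-rtlF []       = refl
  forestLabel-rtlF (t ∷ ts) = begin
      map (forestLabel (t ∷ ts)) (map _ (rtlF ts) ++ map _ (rtl t))
        ≡⟨ map-++ (forestLabel (t ∷ ts)) (map _ (rtlF ts)) (map _ (rtl t)) ⟩
      map (forestLabel (t ∷ ts)) (map _ (rtlF ts)) ++ map (forestLabel (t ∷ ts)) (map _ (rtl t))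
        ≡⟨ cong₂ _++_ (sym (map-∘ (rtlF ts))) (sym (map-∘ (rtl t))) ⟩
      map (forestLabel ts) (rtlF ts) ++ map ((edgesF ts +_) ∘ downsBelow ∘ Φ t) (rtl t)
        ≡⟨ cong₂ _++_ (forestLabel-rtlF ts) (map-∘ (rtl t)) ⟩
      upTo (edgesF ts) ++ map (edgesF ts +_) (map (downsBelow ∘ Φ t) (rtl t))
        ≡⟨ cong (λ l → upTo (edgesF ts) ++ map (edgesF ts +_) l) (downsBelow-Φ-rtl t) ⟩
      upTo (edgesF ts) ++ map (edgesF ts +_) (upTo (suc (edges t)))
        ≡⟨ sym (upTo-+ (edgesF ts) (suc (edges t))) ⟩
      upTo (edgesF ts + suc (edges t))
        ≡⟨ cong upTo (+-comm (edgesF ts) (suc (edges t))) ⟩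
      upTo (suc (edges t) + edgesF ts)
        ∎
    where open ≡-Reasoning

theorem3p2 : (T : Tree) (m : ℕ) → m ≤ edges T →
    Σ (Pos T) (λ w → (vertexLabelled T m ≡ just w) × (downsBelow (Φ T w) ≡ m))
theorem3p2 T m m≤n = map-≡-just (downsBelow ∘ Φ T) (begin
    Maybe.map (downsBelow ∘ Φ T) (nth (rtl T) m)  ≡⟨ sym (nth-map (downsBelow ∘ Φ T) (rtl T) m) ⟩
    nth (map (downsBelow ∘ Φ T) (rtl T)) m        ≡⟨ cong (λ l → nth l m) (downsBelow-Φ-rtl T) ⟩
    nth (upTo (suc (edges T))) m                  ≡⟨ nth-applyUpTo (λ x → x) (s≤s m≤n) ⟩
    just m                                        ∎)
  where open ≡-Reasoning
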